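{- Let $n\geq 7$ be an odd integer and let $p>1$ be an integer. Define the $n$-tuples $\lambda_1=(n-1,2,\ldots,2)$ (with $n-1$ entries equal to $2$), $\lambda_2=\big(\tfrac{n+1}{2},\tfrac{n+1}{2},\tfrac{n+1}{2},\tfrac{n-1}{2},1,\ldots,1\big)$ (with $n-4$ entries equal to $1$), and, for an integer $q$ with $2\leq q<\frac{n-1}{2}$, letting $r=\lfloor \frac{(q-1)(n-2)}{q}\rfloor$ and $\varepsilon=(q-1)(n-2)-qr$, $\lambda_3=\big(n-q,\underbrace{q+1,\ldots,q+1}_{n-r-2},q+1-\varepsilon,\underbrace{1,\ldots,1}_{r}\big)$. Then (i) $\|\lambda_2\|_p^p\leq \|\lambda_1\|_p^p$ and (ii) $\|\lambda_3\|_p^p<\|\lambda_1\|_p^p$.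
   Context: For a real tuple $x=(x_1,\ldots,x_n)$ with nonnegative entries, $\|x\|_p^p=\sum_{i=1}^n x_i^p$. -}

module Defs where

open import Data.Nat using (ℕ; _+_; _*_; _∸_; _^_)
open import Data.Nat.DivMod using (_/_)
open import Data.List using (List; _∷_; []; replicate; map; _++_)
open import Data.Nat.ListAction using (sum)

normPow : ℕ → List ℕ → ℕ
normPow p xs = sum (map (λ x → x ^ p) xs)

lam1 : ℕ → List ℕ
lam1 n = (n ∸ 1) ∷ replicate (n ∸ 1) 2

lam2 : ℕ → List ℕ
lam2 n = ((n + 1) / 2) ∷ ((n + 1) / 2) ∷ ((n + 1) / 2) ∷ ((n ∸ 1) / 2) ∷ replicate (n ∸ 4) 1

rr : ℕ → ℕ → ℕ
rr n q = ((q ∸ 1) * (n ∸ 2)) / (1 + (q ∸ 1))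

eps : ℕ → ℕ → ℕ
eps n q = ((q ∸ 1) * (n ∸ 2)) ∸ q * rr n q

lam3 : ℕ → ℕ → List ℕ
lam3 n q = (n ∸ q) ∷ (replicate (n ∸ rr n q ∸ 2) (q + 1) ++ (((q + 1) ∸ eps n q) ∷ replicate (rr n q) 1))

-- For a threshold c, x^(p+1) + (c - x) x^p = c x^p + (x - c) x^p with truncated
-- subtraction. Summed over a tuple, this shows that an inequality between the p-th
-- power sums of two tuples passes to p + 1 as soon as the excess Σ (x - c) x^p of
-- the smaller tuple plus the deficit Σ (c - x) x^p of the larger one is at most the
-- excess of the larger tuple plus the deficit of the smaller. Write n = 2m + 1.
-- For (i) take c = 2m: no entry exceeds it, and the deficit 4m(m-1) 2^p of λ₁ is
-- dominated by the deficit 3(m-1)(m+1)^p of the first three entries of λ₂, since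
-- 4m 2^p ≤ 3(m+1)^p for p ≥ 2. For (ii) take c = q + 1: only the first entries
-- exceed it, and the excess (2m-q-1)(2m)^p of λ₁ absorbs both the excess
-- (2m-2q)(2m+1-q)^p of λ₃ and the deficit 2m(q-1) 2^p of λ₁. Both inductions start
-- at p = 2, where the sums of squares agree in (i), while in (ii) the division
-- identity q r + ε = (q-1)(n-2) makes their difference (q-1)(n-2q-2) + ε(q-ε) > 0.
module Submission where

open import Data.List using (List; []; _∷_; _++_; replicate; map)
open import Data.List.Properties using (map-++)
open import Data.List.Relation.Unary.All using (All; []; _∷_)
open import Data.List.Relation.Unary.All.Properties using (++⁺; replicate⁺)
open import Data.Nat
open import Data.Nat.DivMod
open import Data.Nat.ListAction using (sum)
open import Data.Nat.ListAction.Properties using (sum-++)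
open import Data.Nat.Properties
open import Algebra.Properties.CommutativeSemigroup +-commutativeSemigroup
  using (interchange)
open import Algebra.Properties.CommutativeSemigroup *-commutativeSemigroup
  using (x∙yz≈y∙xz)
open import Data.Nat.Tactic.RingSolver using (solve-∀)
open import Data.Product using (_×_; _,_; ∃-syntax)
open import Relation.Binary.PropositionalEquality

open import Defs

m+n≡o⇒o∸m≡n : ∀ {m n o} → m + n ≡ o → o ∸ m ≡ n
m+n≡o⇒o∸m≡n {m} {n} refl = m+n∸m≡n m n

m+[n∸m]≡n+[m∸n] : ∀ m n → m + (n ∸ m) ≡ n + (m ∸ n)
m+[n∸m]≡n+[m∸n] zero    n       = sym (trans (cong (n +_) (0∸n≡0 n)) (+-identityʳ n))
m+[n∸m]≡n+[m∸n] (suc m) zero    = +-identityʳ (suc m)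
m+[n∸m]≡n+[m∸n] (suc m) (suc n) = cong suc (m+[n∸m]≡n+[m∸n] m n)

m*2^[2+p]≤m^[2+p] : ∀ {m} p → 4 ≤ m → m * 2 ^ (2 + p) ≤ m ^ (2 + p)
m*2^[2+p]≤m^[2+p] {m} p 4≤m = *-monoʳ-≤ m (begin
  2 * (2 * 2 ^ p) ≡⟨ *-assoc 2 2 (2 ^ p) ⟨
  4 * 2 ^ p       ≤⟨ *-mono-≤ 4≤m (^-monoˡ-≤ p (≤-trans (s≤s (s≤s z≤n)) 4≤m)) ⟩
  m * m ^ p       ∎)
  where open ≤-Reasoning

4m2^[2+p]≤3[1+m]^[2+p] : ∀ {m} p → 3 ≤ m → 4 * m * 2 ^ (2 + p) ≤ 3 * suc m ^ (2 + p)
4m2^[2+p]≤3[1+m]^[2+p] {m@(suc (suc (suc k)))} p (s≤s (s≤s (s≤s _))) = begin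
  4 * m * (2 * (2 * 2 ^ p))      ≡⟨ regroup₁ m (2 ^ p) ⟩
  16 * m * 2 ^ p                 ≤⟨ *-mono-≤ 16m≤3[1+m]² (^-monoˡ-≤ p (s≤s (s≤s z≤n))) ⟩
  3 * suc m * suc m * suc m ^ p  ≡⟨ regroup₂ (suc m) (suc m ^ p) ⟩
  3 * (suc m * (suc m * suc m ^ p)) ∎
  where
  open ≤-Reasoning
  regroup₁ : ∀ m z → 4 * m * (2 * (2 * z)) ≡ 16 * m * z
  regroup₁ = solve-∀
  regroup₂ : ∀ x z → 3 * x * x * z ≡ 3 * (x * (x * z))
  regroup₂ = solve-∀
  square : ∀ k → 3 * (4 + k) * (4 + k) ≡ 16 * (3 + k) + (8 * k + 3 * k * k)
  square = solve-∀
  16m≤3[1+m]² : 16 * m ≤ 3 * suc m * suc m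
  16m≤3[1+m]² = subst (16 * m ≤_) (sym (square k)) (m≤m+n _ _)

e*b^[2+p]+m*[f*2^[2+p]]≤[e+f]*m^[2+p] : ∀ e f {b m} p → b ≤ m → 4 ≤ m →
  e * b ^ (2 + p) + m * (f * 2 ^ (2 + p)) ≤ (e + f) * m ^ (2 + p)
e*b^[2+p]+m*[f*2^[2+p]]≤[e+f]*m^[2+p] e f {b} {m} p b≤m 4≤m = begin
  e * b ^ P + m * (f * 2 ^ P) ≡⟨ cong (e * b ^ P +_) (x∙yz≈y∙xz m f (2 ^ P)) ⟩
  e * b ^ P + f * (m * 2 ^ P) ≤⟨ +-mono-≤ (*-monoʳ-≤ e (^-monoˡ-≤ P b≤m))
                                          (*-monoʳ-≤ f (m*2^[2+p]≤m^[2+p] p 4≤m)) ⟩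
  e * m ^ P + f * m ^ P       ≡⟨ *-distribʳ-+ (m ^ P) e f ⟨
  (e + f) * m ^ P             ∎
  where
  open ≤-Reasoning
  P = 2 + p

normPow-++ : ∀ p xs ys → normPow p (xs ++ ys) ≡ normPow p xs + normPow p ys
normPow-++ p xs ys =
  trans (cong sum (map-++ (_^ p) xs ys)) (sum-++ (map (_^ p) xs) (map (_^ p) ys))

sum-map-replicate : ∀ (f : ℕ → ℕ) k x → sum (map f (replicate k x)) ≡ k * f x
sum-map-replicate f zero    x = refl
sum-map-replicate f (suc k) x = cong (f x +_) (sum-map-replicate f k x)

normPow-replicate : ∀ p k x → normPow p (replicate k x) ≡ k * x ^ p
normPow-replicate p = sum-map-replicate (_^ p)

normPow-replicate-1 : ∀ p k → normPow p (replicate k 1) ≡ k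
normPow-replicate-1 p k =
  trans (normPow-replicate p k 1) (trans (cong (k *_) (^-zeroˡ p)) (*-identityʳ k))

excess deficit : ℕ → ℕ → List ℕ → ℕ
excess  c p xs = sum (map (λ x → (x ∸ c) * x ^ p) xs)
deficit c p xs = sum (map (λ x → (c ∸ x) * x ^ p) xs)

normPow-suc : ∀ c p xs →
  normPow (suc p) xs + deficit c p xs ≡ c * normPow p xs + excess c p xs
normPow-suc c p []       = sym (trans (+-identityʳ (c * 0)) (*-zeroʳ c))
normPow-suc c p (x ∷ xs) = begin
  (x * x ^ p + normPow (suc p) xs) + ((c ∸ x) * x ^ p + deficit c p xs)
    ≡⟨ interchange (x * x ^ p) (normPow (suc p) xs) ((c ∸ x) * x ^ p) (deficit c p xs) ⟩
  (x * x ^ p + (c ∸ x) * x ^ p) + (normPow (suc p) xs + deficit c p xs)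
    ≡⟨ cong₂ _+_ pointwise (normPow-suc c p xs) ⟩
  (c * x ^ p + (x ∸ c) * x ^ p) + (c * normPow p xs + excess c p xs)
    ≡⟨ interchange (c * x ^ p) ((x ∸ c) * x ^ p) (c * normPow p xs) (excess c p xs) ⟩
  (c * x ^ p + c * normPow p xs) + ((x ∸ c) * x ^ p + excess c p xs)
    ≡⟨ cong (_+ ((x ∸ c) * x ^ p + excess c p xs))
            (*-distribˡ-+ c (x ^ p) (normPow p xs)) ⟨
  c * (x ^ p + normPow p xs) + ((x ∸ c) * x ^ p + excess c p xs) ∎
  where
  open ≡-Reasoning
  pointwise : x * x ^ p + (c ∸ x) * x ^ p ≡ c * x ^ p + (x ∸ c) * x ^ p
  pointwise = begin
    x * x ^ p + (c ∸ x) * x ^ p ≡⟨ *-distribʳ-+ (x ^ p) x (c ∸ x) ⟨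
    (x + (c ∸ x)) * x ^ p       ≡⟨ cong (_* x ^ p) (m+[n∸m]≡n+[m∸n] x c) ⟩
    (c + (x ∸ c)) * x ^ p       ≡⟨ *-distribʳ-+ (x ^ p) c (x ∸ c) ⟩
    c * x ^ p + (x ∸ c) * x ^ p ∎

normPow-suc-+ : ∀ c p xs d →
  normPow (suc p) xs + (deficit c p xs + d) ≡ c * normPow p xs + (excess c p xs + d)
normPow-suc-+ c p xs d = begin
  normPow (suc p) xs + (deficit c p xs + d)
    ≡⟨ +-assoc (normPow (suc p) xs) (deficit c p xs) d ⟨
  normPow (suc p) xs + deficit c p xs + d
    ≡⟨ cong (_+ d) (normPow-suc c p xs) ⟩
  c * normPow p xs + excess c p xs + d
    ≡⟨ +-assoc (c * normPow p xs) (excess c p xs) d ⟩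
  c * normPow p xs + (excess c p xs + d) ∎
  where open ≡-Reasoning

normPow-suc-mono-≤ : ∀ c p xs ys → normPow p ys ≤ normPow p xs →
  excess c p ys + deficit c p xs ≤ excess c p xs + deficit c p ys →
  normPow (suc p) ys ≤ normPow (suc p) xs
normPow-suc-mono-≤ c p xs ys ys≤xs balance = +-cancelʳ-≤ D _ _ (begin
  normPow (suc p) ys + D
    ≡⟨ normPow-suc-+ c p ys _ ⟩
  c * normPow p ys + (excess c p ys + deficit c p xs)
    ≤⟨ +-mono-≤ (*-monoʳ-≤ c ys≤xs) balance ⟩
  c * normPow p xs + (excess c p xs + deficit c p ys)
    ≡⟨ normPow-suc-+ c p xs _ ⟨
  normPow (suc p) xs + (deficit c p xs + deficit c p ys)
    ≡⟨ cong (normPow (suc p) xs +_) (+-comm (deficit c p xs) (deficit c p ys)) ⟩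
  normPow (suc p) xs + D ∎)
  where
  open ≤-Reasoning
  D = deficit c p ys + deficit c p xs

normPow-suc-mono-< : ∀ c p xs ys → normPow p ys < normPow p xs →
  excess (suc c) p ys + deficit (suc c) p xs ≤ excess (suc c) p xs + deficit (suc c) p ys →
  normPow (suc p) ys < normPow (suc p) xs
normPow-suc-mono-< c p xs ys ys<xs balance = +-cancelʳ-< D _ _ (begin-strict
  normPow (suc p) ys + D
    ≡⟨ normPow-suc-+ (suc c) p ys _ ⟩
  suc c * normPow p ys + (excess (suc c) p ys + deficit (suc c) p xs)
    <⟨ +-mono-<-≤ (*-monoʳ-< (suc c) ys<xs) balance ⟩
  suc c * normPow p xs + (excess (suc c) p xs + deficit (suc c) p ys)
    ≡⟨ normPow-suc-+ (suc c) p xs _ ⟨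
  normPow (suc p) xs + (deficit (suc c) p xs + deficit (suc c) p ys)
    ≡⟨ cong (normPow (suc p) xs +_) (+-comm (deficit (suc c) p xs) (deficit (suc c) p ys)) ⟩
  normPow (suc p) xs + D ∎)
  where
  open ≤-Reasoning
  D = deficit (suc c) p ys + deficit (suc c) p xs

excess-≤ : ∀ {c} p {xs} → All (_≤ c) xs → excess c p xs ≡ 0
excess-≤ p []           = refl
excess-≤ p (x≤c ∷ xs≤c) rewrite m≤n⇒m∸n≡0 x≤c = excess-≤ p xs≤c

excess-∷-≤ : ∀ {c} p {x xs} → All (_≤ c) xs → excess c p (x ∷ xs) ≡ (x ∸ c) * x ^ p
excess-∷-≤ p xs≤c = trans (cong (_ +_) (excess-≤ p xs≤c)) (+-identityʳ _)

normPow-lam1 : ∀ n p → normPow p (lam1 n) ≡ (n ∸ 1) ^ p + (n ∸ 1) * 2 ^ p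
normPow-lam1 n p = cong ((n ∸ 1) ^ p +_) (normPow-replicate p (n ∸ 1) 2)

deficit-lam1 : ∀ {c} n p → c ≤ n ∸ 1 →
  deficit c p (lam1 n) ≡ (n ∸ 1) * ((c ∸ 2) * 2 ^ p)
deficit-lam1 n p c≤n-1 = cong₂ _+_ (cong (_* (n ∸ 1) ^ p) (m≤n⇒m∸n≡0 c≤n-1))
                                   (sum-map-replicate _ (n ∸ 1) 2)

lam2-odd : ∀ m → lam2 (suc (m * 2)) ≡ suc m ∷ suc m ∷ suc m ∷ m ∷ replicate (m * 2 ∸ 3) 1
lam2-odd m = cong₂ (λ h l → h ∷ h ∷ h ∷ l ∷ replicate (m * 2 ∸ 3) 1) half-up (m*n/n≡m m 2)
  where
  half-up : (suc (m * 2) + 1) / 2 ≡ suc m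
  half-up = trans (cong (_/ 2) (+-comm (suc (m * 2)) 1)) (m*n/n≡m (suc m) 2)

normPow-lam2-odd : ∀ m p →
  normPow p (lam2 (suc (m * 2))) ≡ 3 * suc m ^ p + m ^ p + (m * 2 ∸ 3)
normPow-lam2-odd m p = begin
  normPow p (lam2 (suc (m * 2)))
    ≡⟨ cong (normPow p) (lam2-odd m) ⟩
  suc m ^ p + (suc m ^ p + (suc m ^ p + (m ^ p + normPow p (replicate (m * 2 ∸ 3) 1))))
    ≡⟨ cong (λ t → suc m ^ p + (suc m ^ p + (suc m ^ p + (m ^ p + t))))
            (normPow-replicate-1 p (m * 2 ∸ 3)) ⟩
  suc m ^ p + (suc m ^ p + (suc m ^ p + (m ^ p + (m * 2 ∸ 3))))
    ≡⟨ regroup (suc m ^ p) (m ^ p) (m * 2 ∸ 3) ⟩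
  3 * suc m ^ p + m ^ p + (m * 2 ∸ 3) ∎
  where
  open ≡-Reasoning
  regroup : ∀ a b c → a + (a + (a + (b + c))) ≡ 3 * a + b + c
  regroup = solve-∀

deficit-lam2-odd : ∀ m p →
  3 * ((m * 2 ∸ suc m) * suc m ^ p) ≤ deficit (m * 2) p (lam2 (suc (m * 2)))
deficit-lam2-odd m p = subst (λ xs → 3 * e ≤ deficit (m * 2) p xs) (sym (lam2-odd m))
  (+-monoʳ-≤ e (+-monoʳ-≤ e (+-monoʳ-≤ e z≤n)))
  where e = (m * 2 ∸ suc m) * suc m ^ p

lam2-≤ : ∀ {m} → 1 ≤ m → All (_≤ m * 2) (lam2 (suc (m * 2)))
lam2-≤ {m} 1≤m rewrite lam2-odd m =
  1+m≤2m ∷ 1+m≤2m ∷ 1+m≤2m ∷ m≤m*2 ∷ replicate⁺ _ (≤-trans 1≤m m≤m*2)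
  where
  m≤m*2 : m ≤ m * 2
  m≤m*2 = m≤m*n m 2
  1+m≤2m : suc m ≤ m * 2
  1+m≤2m = subst (suc m ≤_) (sym (trans (*-suc m 1) (cong (m +_) (*-identityʳ m))))
                 (+-monoˡ-≤ m 1≤m)

lam1-≤ : ∀ m → All (_≤ m * 2) (lam1 (suc (m * 2)))
lam1-≤ zero    = z≤n ∷ []
lam1-≤ (suc m) = ≤-refl ∷ replicate⁺ _ (s≤s (s≤s z≤n))

lam2-balance : ∀ {m} p → 3 ≤ m →
  excess (m * 2) (2 + p) (lam2 (suc (m * 2))) + deficit (m * 2) (2 + p) (lam1 (suc (m * 2)))
    ≤ excess (m * 2) (2 + p) (lam1 (suc (m * 2))) + deficit (m * 2) (2 + p) (lam2 (suc (m * 2)))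
lam2-balance {m@(suc (suc (suc k)))} p 3≤m@(s≤s (s≤s (s≤s _))) = begin
  excess c P (lam2 n) + deficit c P (lam1 n)
    ≡⟨ cong₂ _+_ (excess-≤ P (lam2-≤ {m} (s≤s z≤n))) (deficit-lam1 n P ≤-refl) ⟩
  c * ((2 + k) * 2 * 2 ^ P)       ≡⟨ regroup₁ k (2 ^ P) ⟩
  (2 + k) * (4 * m * 2 ^ P)       ≤⟨ *-monoʳ-≤ (2 + k) (4m2^[2+p]≤3[1+m]^[2+p] p 3≤m) ⟩
  (2 + k) * (3 * suc m ^ P)       ≡⟨ x∙yz≈y∙xz (2 + k) 3 (suc m ^ P) ⟩
  3 * ((2 + k) * suc m ^ P)       ≡⟨ cong (λ e → 3 * (e * suc m ^ P)) 2m∸[1+m]≡m-1 ⟨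
  3 * ((c ∸ suc m) * suc m ^ P)   ≤⟨ deficit-lam2-odd m P ⟩
  deficit c P (lam2 n)
    ≡⟨ cong (_+ deficit c P (lam2 n)) (excess-≤ P (lam1-≤ m)) ⟨
  excess c P (lam1 n) + deficit c P (lam2 n) ∎
  where
  open ≤-Reasoning
  P = 2 + p
  n = suc (m * 2)
  c = m * 2
  regroup₁ : ∀ k z → (3 + k) * 2 * ((2 + k) * 2 * z) ≡ (2 + k) * (4 * (3 + k) * z)
  regroup₁ = solve-∀
  split : ∀ k → (4 + k) + (2 + k) ≡ (3 + k) * 2
  split = solve-∀
  2m∸[1+m]≡m-1 : c ∸ suc m ≡ 2 + k
  2m∸[1+m]≡m-1 = m+n≡o⇒o∸m≡n {4 + k} (split k)

normPow₂-lam2≡lam1 : ∀ {m} → 3 ≤ m →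
  normPow 2 (lam2 (suc (m * 2))) ≡ normPow 2 (lam1 (suc (m * 2)))
normPow₂-lam2≡lam1 {m@(suc (suc (suc k)))} (s≤s (s≤s (s≤s _))) = begin
  normPow 2 (lam2 (suc (m * 2)))        ≡⟨ normPow-lam2-odd m 2 ⟩
  3 * suc m ^ 2 + m ^ 2 + (m * 2 ∸ 3)   ≡⟨ squares k ⟩
  (m * 2) ^ 2 + m * 2 * 2 ^ 2           ≡⟨ normPow-lam1 (suc (m * 2)) 2 ⟨
  normPow 2 (lam1 (suc (m * 2)))        ∎
  where
  open ≡-Reasoning
  -- x * (x * 1) is x ^ 2 unfolded: the ring solver does not accept _^_.
  squares : ∀ j → 3 * ((4 + j) * ((4 + j) * 1)) + (3 + j) * ((3 + j) * 1) + (3 + j * 2)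
                  ≡ (3 + j) * 2 * ((3 + j) * 2 * 1) + (3 + j) * 2 * 4
  squares = solve-∀

normPow-lam2≤lam1 : ∀ {m} p → 3 ≤ m →
  normPow (2 + p) (lam2 (suc (m * 2))) ≤ normPow (2 + p) (lam1 (suc (m * 2)))
normPow-lam2≤lam1 zero    3≤m = ≤-reflexive (normPow₂-lam2≡lam1 3≤m)
normPow-lam2≤lam1 {m} (suc p) 3≤m =
  normPow-suc-mono-≤ (m * 2) (2 + p) (lam1 (suc (m * 2))) (lam2 (suc (m * 2)))
    (normPow-lam2≤lam1 p 3≤m) (lam2-balance p 3≤m)

eps≡% : ∀ n q → eps n (suc q) ≡ q * (n ∸ 2) % suc q
eps≡% n q = trans (cong (x ∸_) (*-comm (suc q) (x / suc q))) (sym (m%n≡m∸m/n*n x (suc q)))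
  where x = q * (n ∸ 2)

eps<q : ∀ n q → eps n (suc q) < suc q
eps<q n q = subst (_< suc q) (sym (eps≡% n q)) (m%n<n (q * (n ∸ 2)) (suc q))

q*rr+eps : ∀ n q → suc q * rr n (suc q) + eps n (suc q) ≡ q * (n ∸ 2)
q*rr+eps n q = begin
  suc q * rr n (suc q) + eps n (suc q) ≡⟨ cong₂ _+_ (*-comm (suc q) (x / suc q)) (eps≡% n q) ⟩
  x / suc q * suc q + x % suc q        ≡⟨ +-comm (x / suc q * suc q) (x % suc q) ⟩
  x % suc q + x / suc q * suc q        ≡⟨ m≡m%n+[m/n]*n x (suc q) ⟨
  x                                    ∎
  where
  open ≡-Reasoning
  x = q * (n ∸ 2)

rr≤n∸2 : ∀ n q → rr n (suc q) ≤ n ∸ 2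
rr≤n∸2 n q = begin
  q * (n ∸ 2) / suc q       ≤⟨ /-monoˡ-≤ (suc q) (*-monoˡ-≤ (n ∸ 2) (n≤1+n q)) ⟩
  suc q * (n ∸ 2) / suc q   ≡⟨ cong (_/ suc q) (*-comm (suc q) (n ∸ 2)) ⟩
  (n ∸ 2) * suc q / suc q   ≡⟨ m*n/n≡m (n ∸ 2) (suc q) ⟩
  n ∸ 2                     ∎
  where open ≤-Reasoning

lam3-counts : ∀ n q → (n ∸ rr n (suc q) ∸ 2) + rr n (suc q) ≡ n ∸ 2
lam3-counts n q = begin
  n ∸ r ∸ 2 + r   ≡⟨ cong (_+ r) (∸-+-assoc n r 2) ⟩
  n ∸ (r + 2) + r ≡⟨ cong (λ t → n ∸ t + r) (+-comm r 2) ⟩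
  n ∸ (2 + r) + r ≡⟨ cong (_+ r) (∸-+-assoc n 2 r) ⟨
  n ∸ 2 ∸ r + r   ≡⟨ m∸n+n≡m (rr≤n∸2 n q) ⟩
  n ∸ 2           ∎
  where
  open ≡-Reasoning
  r = rr n (suc q)

normPow-lam3 : ∀ n q p → normPow p (lam3 n q) ≡
  (n ∸ q) ^ p + ((n ∸ rr n q ∸ 2) * (q + 1) ^ p + ((q + 1 ∸ eps n q) ^ p + rr n q))
normPow-lam3 n q p = cong ((n ∸ q) ^ p +_) (begin
  normPow p (replicate a (q + 1) ++ w ∷ replicate r 1)
    ≡⟨ normPow-++ p (replicate a (q + 1)) (w ∷ replicate r 1) ⟩
  normPow p (replicate a (q + 1)) + (w ^ p + normPow p (replicate r 1))
    ≡⟨ cong₂ (λ x y → x + (w ^ p + y))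
             (normPow-replicate p a (q + 1)) (normPow-replicate-1 p r) ⟩
  a * (q + 1) ^ p + (w ^ p + r) ∎)
  where
  open ≡-Reasoning
  r = rr n q
  a = n ∸ r ∸ 2
  w = q + 1 ∸ eps n q

[q+1∸ε]²+[q+2]ε≤[q+1]² : ∀ {ε q} → ε ≤ q → (q + 1 ∸ ε) ^ 2 + (q + 2) * ε ≤ (q + 1) ^ 2
[q+1∸ε]²+[q+2]ε≤[q+1]² {ε} ε≤q with m≤n⇒∃[o]m+o≡n ε≤q
... | t , refl = begin
  (ε + t + 1 ∸ ε) ^ 2 + (ε + t + 2) * ε ≡⟨ cong (λ x → x ^ 2 + (ε + t + 2) * ε) w≡t+1 ⟩
  (t + 1) ^ 2 + (ε + t + 2) * ε         ≤⟨ m≤m+n _ (ε * t) ⟩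
  (t + 1) ^ 2 + (ε + t + 2) * ε + ε * t ≡⟨ expand ε t ⟩
  (ε + t + 1) ^ 2                       ∎
  where
  open ≤-Reasoning
  w≡t+1 : ε + t + 1 ∸ ε ≡ t + 1
  w≡t+1 = trans (cong (_∸ ε) (+-assoc ε t 1)) (m+n∸m≡n ε (t + 1))
  expand : ∀ ε t → (t + 1) * ((t + 1) * 1) + (ε + t + 2) * ε + ε * t
                   ≡ (ε + t + 1) * ((ε + t + 1) * 1)
  expand = solve-∀

lam3-head : ∀ s d → suc ((3 + s + d) * 2) ∸ (2 + s) ≡ 5 + s + d * 2
lam3-head s d = m+n≡o⇒o∸m≡n {2 + s} (split s d)
  where
  split : ∀ s d → (2 + s) + (5 + s + d * 2) ≡ suc ((3 + s + d) * 2)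
  split = solve-∀

normPow₂-lam3<lam1 : ∀ s d →
  normPow 2 (lam3 (suc ((3 + s + d) * 2)) (2 + s))
    < normPow 2 (lam1 (suc ((3 + s + d) * 2)))
normPow₂-lam3<lam1 s d = +-cancelʳ-< K _ _ (begin-strict
  normPow 2 (lam3 n q) + K
    ≡⟨ cong₂ _+_ (normPow-lam3 n q 2) (cong ((q + 2) *_) (sym (q*rr+eps n (suc s)))) ⟩
  B ^ 2 + (a * (q + 1) ^ 2 + (w ^ 2 + r)) + (q + 2) * (q * r + ε)
    ≡⟨ regroup B a w r ε q ⟩
  B ^ 2 + (w ^ 2 + (q + 2) * ε) + (a + r) * (q + 1) ^ 2
    ≡⟨ cong (λ t → B ^ 2 + (w ^ 2 + (q + 2) * ε) + t * (q + 1) ^ 2) (lam3-counts n (suc s)) ⟩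
  B ^ 2 + (w ^ 2 + (q + 2) * ε) + S * (q + 1) ^ 2
    ≤⟨ +-monoˡ-≤ (S * (q + 1) ^ 2)
         (+-monoʳ-≤ (B ^ 2) ([q+1∸ε]²+[q+2]ε≤[q+1]² (<⇒≤ (eps<q n (suc s))))) ⟩
  B ^ 2 + (q + 1) ^ 2 + S * (q + 1) ^ 2
    ≡⟨ cong (λ b → b ^ 2 + (q + 1) ^ 2 + S * (q + 1) ^ 2) (lam3-head s d) ⟩
  (5 + s + d * 2) ^ 2 + (q + 1) ^ 2 + S * (q + 1) ^ 2
    <⟨ m<m+n _ (s≤s z≤n) ⟩
  (5 + s + d * 2) ^ 2 + (q + 1) ^ 2 + S * (q + 1) ^ 2 + (1 + s) * (1 + d * 2)
    ≡⟨ squares s d ⟩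
  (n ∸ 1) ^ 2 + (n ∸ 1) * 2 ^ 2 + K
    ≡⟨ cong (_+ K) (normPow-lam1 n 2) ⟨
  normPow 2 (lam1 n) + K ∎)
  where
  open ≤-Reasoning
  n = suc ((3 + s + d) * 2)
  q = 2 + s
  r = rr n q
  ε = eps n q
  a = n ∸ r ∸ 2
  w = q + 1 ∸ ε
  B = n ∸ q
  S = n ∸ 2
  -- K = (q + 2)(q r + ε) is added to both sides so that the division identity
  -- for r and ε enters linearly.
  K = (q + 2) * ((1 + s) * S)
  regroup : ∀ B a w r ε q →
    B * (B * 1) + (a * ((q + 1) * ((q + 1) * 1)) + (w * (w * 1) + r)) + (q + 2) * (q * r + ε)
    ≡ B * (B * 1) + (w * (w * 1) + (q + 2) * ε) + (a + r) * ((q + 1) * ((q + 1) * 1))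
  regroup = solve-∀
  squares : ∀ s d →
    (5 + s + d * 2) * ((5 + s + d * 2) * 1) + (2 + s + 1) * ((2 + s + 1) * 1)
      + (1 + (2 + s + d) * 2) * ((2 + s + 1) * ((2 + s + 1) * 1)) + (1 + s) * (1 + d * 2)
    ≡ (3 + s + d) * 2 * ((3 + s + d) * 2 * 1) + (3 + s + d) * 2 * 4
      + (2 + s + 2) * ((1 + s) * (1 + (2 + s + d) * 2))
  squares = solve-∀

lam3-balance : ∀ s d p →
  let n = suc ((3 + s + d) * 2); c = 2 + s + 1 in
  excess c (2 + p) (lam3 n (2 + s)) + deficit c (2 + p) (lam1 n)
    ≤ excess c (2 + p) (lam1 n) + deficit c (2 + p) (lam3 n (2 + s))
lam3-balance s d p = begin
  excess c P (lam3 n q) + deficit c P (lam1 n)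
    ≡⟨ cong₂ _+_ (excess-∷-≤ P {B} tail≤c) (deficit-lam1 n P c≤M) ⟩
  (B ∸ c) * B ^ P + M * ((c ∸ 2) * 2 ^ P)
    ≤⟨ e*b^[2+p]+m*[f*2^[2+p]]≤[e+f]*m^[2+p] (B ∸ c) (c ∸ 2) p
         (∸-monoʳ-≤ {1} {q} n (s≤s z≤n)) (s≤s (s≤s (s≤s (s≤s z≤n)))) ⟩
  ((B ∸ c) + (c ∸ 2)) * M ^ P
    ≡⟨ cong (_* M ^ P) gaps ⟩
  (M ∸ c) * M ^ P
    ≡⟨ excess-∷-≤ {c} P {M} (replicate⁺ M (s≤s (s≤s z≤n))) ⟨
  excess c P (lam1 n)
    ≤⟨ m≤m+n _ _ ⟩
  excess c P (lam1 n) + deficit c P (lam3 n q) ∎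
  where
  open ≤-Reasoning
  P = 2 + p
  n = suc ((3 + s + d) * 2)
  q = 2 + s
  c = q + 1
  M = n ∸ 1
  B = n ∸ q
  tail≤c :
    All (_≤ c) (replicate (n ∸ rr n q ∸ 2) c ++ (c ∸ eps n q) ∷ replicate (rr n q) 1)
  tail≤c = ++⁺ (replicate⁺ _ ≤-refl) (m∸n≤m c (eps n q) ∷ replicate⁺ _ (s≤s z≤n))
  splitB : ∀ s d → (2 + s + 1) + (2 + d * 2) ≡ 5 + s + d * 2
  splitB = solve-∀
  splitM : ∀ s d → (2 + s + 1) + ((2 + d * 2) + (s + 1)) ≡ (3 + s + d) * 2
  splitM = solve-∀
  c≤M : c ≤ M
  c≤M = subst (c ≤_) (splitM s d) (m≤m+n c _)
  gaps : (B ∸ c) + (c ∸ 2) ≡ M ∸ c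
  gaps = begin-equality
    (B ∸ c) + (s + 1)               ≡⟨ cong (λ b → (b ∸ c) + (s + 1)) (lam3-head s d) ⟩
    (5 + s + d * 2 ∸ c) + (s + 1)   ≡⟨ cong (_+ (s + 1)) (m+n≡o⇒o∸m≡n {c} (splitB s d)) ⟩
    (2 + d * 2) + (s + 1)           ≡⟨ m+n≡o⇒o∸m≡n {c} (splitM s d) ⟨
    M ∸ c                           ∎

normPow-lam3<lam1 : ∀ {m q} p → 2 ≤ q → q < m →
  normPow (2 + p) (lam3 (suc (m * 2)) q) < normPow (2 + p) (lam1 (suc (m * 2)))
normPow-lam3<lam1 {q = suc (suc s)} p (s≤s (s≤s z≤n)) q<m with m≤n⇒∃[o]m+o≡n q<m
... | d , refl = go p
  where
  n = suc ((3 + s + d) * 2)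
  go : ∀ p → normPow (2 + p) (lam3 n (2 + s)) < normPow (2 + p) (lam1 n)
  go zero    = normPow₂-lam3<lam1 s d
  go (suc p) = normPow-suc-mono-< (1 + s + 1) (2 + p) (lam1 n) (lam3 n (2 + s))
                 (go p) (lam3-balance s d p)

odd≥7⇒≡1+m*2 : ∀ {n} → 7 ≤ n → n % 2 ≡ 1 → ∃[ m ] 3 ≤ m × n ≡ suc (m * 2)
odd≥7⇒≡1+m*2 {n} 7≤n n-odd = n / 2 , 3≤n/2 , n≡
  where
  n≡ : n ≡ suc (n / 2 * 2)
  n≡ = trans (m≡m%n+[m/n]*n n 2) (cong (_+ n / 2 * 2) n-odd)
  3≤n/2 : 3 ≤ n / 2
  3≤n/2 = *-cancelʳ-≤ 3 (n / 2) 2 (≤-pred (subst (7 ≤_) n≡ 7≤n))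

lemma1 : (n p : ℕ) → 7 ≤ n → n % 2 ≡ 1 → 2 ≤ p →
    (normPow p (lam2 n) ≤ normPow p (lam1 n))
    × ((q : ℕ) → 2 ≤ q → 2 * q < n ∸ 1 →
       normPow p (lam3 n q) < normPow p (lam1 n))
lemma1 n (suc (suc p)) 7≤n n-odd (s≤s (s≤s z≤n)) with odd≥7⇒≡1+m*2 7≤n n-odd
... | m , 3≤m , refl = normPow-lam2≤lam1 p 3≤m , part-ii
  where
  part-ii : (q : ℕ) → 2 ≤ q → 2 * q < m * 2 →
    normPow (2 + p) (lam3 (suc (m * 2)) q) < normPow (2 + p) (lam1 (suc (m * 2)))
  part-ii q 2≤q 2q<2m =
    normPow-lam3<lam1 p 2≤q (*-cancelʳ-< 2 q m (subst (_< m * 2) (*-comm 2 q) 2q<2m))
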